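{- Let $(\mathbb P_n,\geq_n)_{n\in\mathbb N}$ be a level-injective $\omega$-chain with associated poset $\mathbb P$. Then for every $n$, the family $\mathbb P_n^\in=\{p^\in:p\in\mathbb P_n\}$ is a minimal cover of $\mathrm{Sp}\,\mathbb P$. In particular, $p^\in\neq\emptyset$ for every $p\in\mathbb P$.
   Context: For a relation $R\subseteq A\times B$: $R$ is co-surjective if every $b\in B$ has some $a$ with $aRb$; co-injective if every $a\in A$ has some $b$ with $aRb$ such that no $a'\ne a$ has $a'Rb$. An $\omega$-chain $(\mathbb P_n,\geq_n)$ consists of finite sets $\mathbb P_n$ and co-surjective relations $\geq_n\subseteq\mathbb P_n\times\mathbb P_{n+1}$; its poset is $\mathbb P=\bigsqcup_n\mathbb P_n$ ordered by the reflexive transitive closure $\geq$ of $\bigsqcup_n\geq_n$. It is level-injective if every $\geq_n$ is co-injective. A band in $\mathbb P$ is a finite $B\subseteq\mathbb P$ such that every $p\in\mathbb P$ is comparable with some $b\in B$. A cap is a set $C\subseteq\mathbb P$ such that for some band $B$, every $b\in B$ satisfies $b\le c$ for some $c\in C$. A selector is a subset of $\mathbb P$ meeting every cap. $\mathrm{Sp}\,\mathbb P$ is the set of inclusion-minimal selectors, and for $p\in\mathbb P$, $p^\in=\{S\in\mathrm{Sp}\,\mathbb P: p\in S\}$. -}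

module Defs where

open import Level using (Level; 0ℓ; Setω)
open import Data.Nat using (ℕ; suc)
open import Data.Fin using (Fin)
open import Data.Product using (Σ; ∃; _×_; _,_)
open import Data.Sum using (_⊎_)
open import Data.List using (List)
open import Data.List.Membership.Propositional using (_∈_)
open import Relation.Nullary using (¬_)
open import Relation.Binary.PropositionalEquality using (_≡_; _≢_)
open import Relation.Binary.Construct.Closure.ReflexiveTransitive using (Star)

-- Law of excluded middle at every universe level (ambient classical logic of the paper).
LEM : Setω
LEM = ∀ {ℓ : Level} (A : Set ℓ) → A ⊎ ¬ A

-- An ω-chain: finite levels ℙ_n = Fin (size n) and relations ≥_n ⊆ ℙ_n × ℙ_{n+1},
-- where  R n a b  means  a ≥_n b.
record OmegaChain : Set₁ where
  field
    size : ℕ → ℕ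
    R    : (n : ℕ) → Fin (size n) → Fin (size (suc n)) → Set
    coSurj : ∀ n (b : Fin (size (suc n))) → ∃ λ a → R n a b

  Elt : Set
  Elt = Σ ℕ (λ n → Fin (size n))

  data Step : Elt → Elt → Set where
    step : ∀ {n a b} → R n a b → Step (n , a) (suc n , b)

  _≥_ : Elt → Elt → Set
  _≥_ = Star Step

  _≤_ : Elt → Elt → Set
  p ≤ q = q ≥ p

  Comparable : Elt → Elt → Set
  Comparable p q = (p ≤ q) ⊎ (q ≤ p)

  Subset : Set₁
  Subset = Elt → Set

  IsBand : List Elt → Set
  IsBand B = ∀ p → ∃ λ b → b ∈ B × Comparable p b

  IsCap : Subset → Set
  IsCap C = ∃ λ B → IsBand B × (∀ b → b ∈ B → ∃ λ c → C c × b ≤ c)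

  IsSelector : Subset → Set₁
  IsSelector S = ∀ C → IsCap C → ∃ λ x → C x × S x

  _⊆_ : Subset → Subset → Set
  S ⊆ T = ∀ x → S x → T x

  Sp : Subset → Set₁
  Sp S = IsSelector S × (∀ S' → IsSelector S' → S' ⊆ S → S ⊆ S')

  _^∈ : Elt → Subset → Set₁
  (p ^∈) S = Sp S × S p

CoInjective : {A B : Set} → (A → B → Set) → Set
CoInjective {A} {B} R = ∀ a → ∃ λ b → R a b × (∀ a' → R a' b → a' ≡ a)

LevelInjective : OmegaChain → Set
LevelInjective c = ∀ n → CoInjective (OmegaChain.R c n)

-- A family F indexed by I of subsets of X (elements of X are subsets of ℙ) is a
-- minimal cover of U: each member lies inside U, the members cover U, and removing
-- any single member leaves a family that no longer covers U.
MinimalCover : {X : Set₁} (I : Set) → (I → X → Set₁) → (X → Set₁) → Set₁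
MinimalCover {X} I F U =
  (∀ i x → F i x → U x) ×
  (∀ x → U x → ∃ λ i → F i x) ×
  (∀ i → ¬ (∀ x → U x → ∃ λ j → j ≢ i × F j x))

-- Level-injectivity gives every p a private branch p = p₀ ≥ p₁ ≥ p₂ ≥ …, each pₖ₊₁ having pₖ
-- as its only predecessor. The down-set of such a branch is a minimal selector: it meets
-- every cap because a band is finite and so lies above some point of the branch, and it is
-- minimal because a selector strictly inside it would miss the cap formed by one of its
-- points q together with the elements of a deeper level that do not lie below q. Every
-- minimal selector meets level n, a level being itself a band, so ℙₙ^∈ covers; and the
-- branch selector of p meets level n only in p, so no member of ℙₙ^∈ can be dropped.
module Submission where

open import Defs
open import Data.Nat using (ℕ; zero; suc; _+_; _≤_; _<_; _≤′_; ≤′-refl; ≤′-step; s≤s)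
open import Data.Nat.Properties using (≤-refl; ≤-trans; n≤1+n; <⇒≱; 1+n≰n; m≤m+n; m≤n+m; +-cancelʳ-≡; ≤⇒≤′; ≤-total)
open import Data.Fin using (Fin)
open import Data.Product using (∃; _×_; _,_; proj₁)
open import Data.Sum using (_⊎_; inj₁; inj₂)
open import Data.Empty using (⊥-elim)
open import Data.List using (List; map; allFin)
open import Data.List.Extrema.Nat using (max; xs≤max)
open import Data.List.Membership.Propositional using (_∈_)
open import Data.List.Membership.Propositional.Properties using (∈-map⁺; ∈-map⁻; ∈-allFin)
import Data.List.Relation.Unary.All as All
open import Relation.Nullary using (¬_)
open import Relation.Binary.PropositionalEquality using (_≡_; _≢_; refl; sym; cong; subst)
open import Relation.Binary.Construct.Closure.ReflexiveTransitive using (ε; _◅_; _◅◅_)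

HasSuccessors : OmegaChain → Set
HasSuccessors c = ∀ n a → ∃ λ b → OmegaChain.R c n a b

LevelInjective⇒HasSuccessors : ∀ c → LevelInjective c → HasSuccessors c
LevelInjective⇒HasSuccessors c inj n a with inj n a
... | b , r , _ = b , r

module Levels (c : OmegaChain) where
  open OmegaChain c hiding (_≤_)

  level : Elt → ℕ
  level = proj₁

  step-level : ∀ {x y} → Step x y → level y ≡ suc (level x)
  step-level (step _) = refl

  ≥⇒level≤ : ∀ {x y} → x ≥ y → level x ≤ level y
  ≥⇒level≤ ε              = ≤-refl
  ≥⇒level≤ (step _ ◅ x≥y) = ≤-trans (n≤1+n _) (≥⇒level≤ x≥y)

  ≥-unsnoc : ∀ {x z} → x ≥ z → x ≡ z ⊎ ∃ λ y → x ≥ y × Step y z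
  ≥-unsnoc ε = inj₁ refl
  ≥-unsnoc (s ◅ x≥z) with ≥-unsnoc x≥z
  ... | inj₁ refl            = inj₂ (_ , ε , s)
  ... | inj₂ (y , x≥y , y→z) = inj₂ (y , s ◅ x≥y , y→z)

  ancestor : ∀ {m k} → m ≤′ k → ∀ b → ∃ λ a → (m , a) ≥ (k , b)
  ancestor ≤′-refl b = b , ε
  ancestor {k = suc k} (≤′-step m≤k) b with coSurj k b
  ... | b′ , r with ancestor m≤k b′
  ... | a , a≥b′ = a , a≥b′ ◅◅ (step r ◅ ε)

  InLayer : ℕ → Subset
  InLayer n x = ∃ λ a → x ≡ (n , a)

  Layer : ℕ → List Elt
  Layer n = map (n ,_) (allFin (size n))

  ∈-Layer : ∀ n a → (n , a) ∈ Layer n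
  ∈-Layer n a = ∈-map⁺ (n ,_) (∈-allFin a)

  ∈-Layer⁻ : ∀ {n x} → x ∈ Layer n → InLayer n x
  ∈-Layer⁻ {n} x∈ with ∈-map⁻ (n ,_) x∈
  ... | a , _ , refl = a , refl

  depth : List Elt → ℕ
  depth B = max 0 (map level B)

  level≤depth : ∀ {b B} → b ∈ B → level b ≤ depth B
  level≤depth {B = B} b∈B = All.lookup (xs≤max 0 (map level B)) (∈-map⁺ level b∈B)

  IsBand⇒above-deep : ∀ {B} → IsBand B → ∀ x → depth B < level x → ∃ λ b → b ∈ B × b ≥ x
  IsBand⇒above-deep band x deep with band x
  ... | b , b∈B , inj₁ b≥x = b , b∈B , b≥x
  ... | b , b∈B , inj₂ x≥b = ⊥-elim (<⇒≱ deep (≤-trans (≥⇒level≤ x≥b) (level≤depth b∈B)))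

module Successors (c : OmegaChain) (succ : HasSuccessors c) where
  open OmegaChain c hiding (_≤_)
  open Levels c

  descendant : ∀ {m k} → m ≤′ k → ∀ a → ∃ λ b → (m , a) ≥ (k , b)
  descendant ≤′-refl a = a , ε
  descendant {k = suc k} (≤′-step m≤k) a with descendant m≤k a
  ... | b′ , a≥b′ with succ k b′
  ... | b , r = b , a≥b′ ◅◅ (step r ◅ ε)

  Layer-isBand : ∀ n → IsBand (Layer n)
  Layer-isBand n (k , b) with ≤-total k n
  ... | inj₁ k≤n with descendant (≤⇒≤′ k≤n) b
  ...   | a , b≥a = (n , a) , ∈-Layer n a , inj₂ b≥a
  Layer-isBand n (k , b) | inj₂ n≤k with ancestor (≤⇒≤′ n≤k) b
  ...   | a , a≥b = (n , a) , ∈-Layer n a , inj₁ a≥b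

  above-Layer⇒isCap : ∀ {C} n → (∀ a → ∃ λ x → C x × x ≥ (n , a)) → IsCap C
  above-Layer⇒isCap {C} n above = Layer n , Layer-isBand n , λ b b∈ → from-layer (∈-Layer⁻ b∈)
    where
    from-layer : ∀ {b} → InLayer n b → ∃ λ x → C x × x ≥ b
    from-layer (a , refl) = above a

  InLayer-isCap : ∀ n → IsCap (InLayer n)
  InLayer-isCap n = above-Layer⇒isCap n λ a → (n , a) , (a , refl) , ε

  Separator : ℕ → Elt → Subset
  Separator n q x = x ≡ q ⊎ (InLayer n x × ¬ q ≥ x)

  Separator-isCap : LEM → ∀ n q → IsCap (Separator n q)
  Separator-isCap lem n q = above-Layer⇒isCap n separate
    where
    separate : ∀ a → ∃ λ x → Separator n q x × x ≥ (n , a)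
    separate a with lem (q ≥ (n , a))
    ... | inj₁ q≥a = q , inj₁ refl , q≥a
    ... | inj₂ q≱a = (n , a) , inj₂ ((a , refl) , q≱a) , ε

module PrivateBranch (c : OmegaChain) (inj : LevelInjective c) (n : ℕ) (root : Fin (OmegaChain.size c n)) where
  open OmegaChain c hiding (_≤_)
  open Levels c
  open Successors c (LevelInjective⇒HasSuccessors c inj)

  branch : ∀ K → Fin (size (K + n))
  branch zero    = root
  branch (suc K) = proj₁ (inj (K + n) (branch K))

  point : ℕ → Elt
  point K = (K + n , branch K)

  predecessor-of-point : ∀ K {y} → Step y (point (suc K)) → y ≡ point K
  predecessor-of-point K (step r) with inj (K + n) (branch K)
  ... | _ , _ , unique = cong (K + n ,_) (unique _ r)

  above-point⇒on-branch : ∀ K {w} → w ≥ point K → n ≤ level w → ∃ λ j → w ≡ point j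
  above-point⇒on-branch K w≥p n≤w with ≥-unsnoc w≥p
  ... | inj₁ w≡p = K , w≡p
  above-point⇒on-branch zero {w} w≥p n≤w | inj₂ (y , w≥y , y→p) =
    ⊥-elim (1+n≰n (≤-trans (subst (_≤ level w) (step-level y→p) n≤w) (≥⇒level≤ w≥y)))
  above-point⇒on-branch (suc K) {w} w≥p n≤w | inj₂ (y , w≥y , y→p) =
    above-point⇒on-branch K (subst (w ≥_) (predecessor-of-point K y→p) w≥y) n≤w

  Below : Subset
  Below x = ∃ λ K → x ≥ point K

  Below-root : Below (n , root)
  Below-root = zero , ε

  Below-at-level : ∀ K {b} → Below (K + n , b) → (K + n , b) ≡ point K
  Below-at-level K (j , b≥p) with above-point⇒on-branch j b≥p (m≤n+m n K)
  ... | i , b≡pᵢ with +-cancelʳ-≡ n K i (cong level b≡pᵢ)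
  ... | refl = b≡pᵢ

  Below-isSelector : IsSelector Below
  Below-isSelector C (B , band , B⊑C) with IsBand⇒above-deep band (point (suc (depth B))) deep
    where
    deep : depth B < suc (depth B + n)
    deep = s≤s (m≤m+n (depth B) n)
  ... | b , b∈B , b≥p with B⊑C b b∈B
  ... | x , Cx , x≥b = x , Cx , suc (depth B) , x≥b ◅◅ b≥p

  Below-minimal : LEM → ∀ S → IsSelector S → S ⊆ Below → Below ⊆ S
  Below-minimal lem S sel S⊆Below q (K , q≥p) with sel (Separator (K + n) q) (Separator-isCap lem (K + n) q)
  ... | _ , inj₁ refl , Sq = Sq
  ... | _ , inj₂ ((b , refl) , q≱b) , Sb =
    ⊥-elim (q≱b (subst (q ≥_) (sym (Below-at-level K (S⊆Below _ Sb))) q≥p))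

  Below-Sp : LEM → Sp Below
  Below-Sp lem = Below-isSelector , Below-minimal lem

module _ (lem : LEM) (c : OmegaChain) (inj : LevelInjective c) where
  open OmegaChain c hiding (_≤_)
  open Levels c using (InLayer)
  open Successors c (LevelInjective⇒HasSuccessors c inj) using (InLayer-isCap)
  open PrivateBranch c inj using (Below; Below-Sp; Below-at-level)

  Layer-minimalCover : ∀ n → MinimalCover (Fin (size n)) (λ a → (n , a) ^∈) Sp
  Layer-minimalCover n = (λ _ _ → proj₁) , cover , minimal
    where
    cover : ∀ S → Sp S → ∃ λ a → ((n , a) ^∈) S
    cover S Sp-S with proj₁ Sp-S (InLayer n) (InLayer-isCap n)
    ... | _ , (a , refl) , Sa = a , Sp-S , Sa

    minimal : ∀ a → ¬ (∀ S → Sp S → ∃ λ b → b ≢ a × ((n , b) ^∈) S)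
    minimal a covered with covered (Below n a) (Below-Sp n a lem)
    ... | b , b≢a , _ , Below-b with Below-at-level n a zero Below-b
    ... | refl = b≢a refl

mainTheorem17 : LEM → (c : OmegaChain) → LevelInjective c →
    let open OmegaChain c in
    (∀ (n : ℕ) → MinimalCover (Fin (size n)) (λ p → (n , p) ^∈) Sp)
    × (∀ (p : Elt) → ∃ λ S → (p ^∈) S)
mainTheorem17 lem c inj =
  Layer-minimalCover lem c inj ,
  λ (n , a) → Below n a , Below-Sp n a lem , Below-root n a
  where open PrivateBranch c inj using (Below; Below-Sp; Below-root)
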